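{- Let $1\le a<b<c\le n$ and let $M$ be the (shifted) rank $3$ matroid on $[n]$ whose set of bases is $\mathcal{B}(M)=\{\{a',b',c'\}:1\le a'<b'<c'\le n,\ a'\le a,\ b'\le b,\ c'\le c\}$. Then $M$ is DJS if and only if $\lfloor\frac{c-b}{2}\rfloor<a$.
   Context: A rank $3$ matroid $M$ on $[n]$ with set of bases $\mathcal{B}(M)$ is called DJS if, letting $E'$ be the set of non-loop elements of $M$, every ordering $w_1w_2\cdots w_m$ of $E'$ has some $j$ with $\{w_j,w_{j+1},w_{j+2}\}\in\mathcal{B}(M)$. -}

module Defs where

open import Data.Nat using (ℕ; _≤_; _<_)
open import Data.List using (List; []; _∷_; _++_)
open import Data.List.Membership.Propositional using (_∈_)
open import Data.List.Relation.Unary.Unique.Propositional using (Unique)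
open import Data.List.Relation.Binary.Permutation.Propositional using (_↭_)
open import Data.Product using (Σ; ∃; _×_)
open import Function.Bundles using (_⇔_)
open import Relation.Binary.PropositionalEquality using (_≡_)

-- The family of bases is given by a predicate on triples: IsBasis x y z means
-- that the set {x,y,z} belongs to 𝓑(M).
Bases₃ : Set₁
Bases₃ = ℕ → ℕ → ℕ → Set

NonLoop : ℕ → Bases₃ → ℕ → Set
NonLoop n B e = (1 ≤ e) × (e ≤ n) × ∃ λ y → ∃ λ z → B e y z

IsOrderingOfNonLoops : ℕ → Bases₃ → List ℕ → Set
IsOrderingOfNonLoops n B w = Unique w × (∀ e → (e ∈ w) ⇔ NonLoop n B e)

HasConsecutiveBasis : Bases₃ → List ℕ → Set
HasConsecutiveBasis B w =
  ∃ λ (p : List ℕ) → ∃ λ x → ∃ λ y → ∃ λ z → ∃ λ (r : List ℕ) →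
    (w ≡ p ++ (x ∷ y ∷ z ∷ r)) × B x y z

DJS : ℕ → Bases₃ → Set
DJS n B = ∀ (w : List ℕ) → IsOrderingOfNonLoops n B w → HasConsecutiveBasis B w

ShiftedBasis : ℕ → ℕ → ℕ → ℕ → Bases₃
ShiftedBasis n a b c x y z =
  ∃ λ a' → ∃ λ b' → ∃ λ c' →
    (1 ≤ a') × (a' < b') × (b' < c') × (c' ≤ n) ×
    (a' ≤ a) × (b' ≤ b) × (c' ≤ c) ×
    ((x ∷ y ∷ z ∷ []) ↭ (a' ∷ b' ∷ c' ∷ []))

{-# OPTIONS --safe #-}
module Submission where

-- Label each element e ≤ c by A if e ≤ a, B if a < e ≤ b and C if b < e (elements beyond c are
-- loops). Distinct x, y, z ∈ [1, c] form a basis iff their labels contain an A and at most one C,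
-- so only the label word of an ordering matters. If no three consecutive letters form a basis,
-- no A is within distance two of another A or B. Then every A is followed by two C's, except
-- possibly an A among the last two letters; a B (there are b − a ≥ 1 of them) must likewise be
-- followed by two C's before any later A, which pays for that exception, so 2a ≤ c − b.
-- Conversely, when 2a ≤ c − b the ordering with label word (A C C)ᵃ Bᵇ⁻ᵃ Cᶜ⁻ᵇ⁻²ᵃ has no
-- consecutive basis.

open import Defs
open import Data.Nat using (ℕ; zero; suc; _+_; _*_; _∸_; _≤_; _<_; _≤?_; _≟_; z≤n; s≤s; NonZero)
open import Data.Nat.Properties
open import Data.Nat.DivMod using (_/_; m*n/n≡m; /-monoˡ-≤; m/n*n≤m)
open import Data.Nat.ListAction using (sum)
open import Data.Nat.ListAction.Properties using (sum-++; sum-↭)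
open import Data.List using (List; []; _∷_; _++_; _∷ʳ_; map; replicate; length)
open import Data.List.Properties using (map-++; length-map; ++-assoc)
open import Data.List.Membership.Propositional using (_∈_)
open import Data.List.Membership.Propositional.Properties.WithK using (unique∧set⇒bag)
open import Data.List.Relation.Binary.BagAndSetEquality using (∼bag⇒↭)
open import Data.List.Relation.Unary.Any using (here; there)
open import Data.List.Relation.Unary.All using (All; []; _∷_)
import Data.List.Relation.Unary.All as All
import Data.List.Relation.Unary.All.Properties as All
open import Data.List.Relation.Unary.Unique.Propositional using (Unique)
open import Data.List.Relation.Unary.AllPairs using ([]; _∷_)
import Data.List.Relation.Unary.Unique.Propositional.Properties as Unique
open import Data.List.Relation.Binary.Permutation.Propositional
  using (_↭_; ↭-refl; ↭-sym; ↭-trans; prep; swap; ↭⇒↭ₛ; module PermutationReasoning)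
open import Data.List.Relation.Binary.Permutation.Propositional.Properties
  using (∈-resp-↭; All-resp-↭; map⁺; ++⁺ˡ; ++⁺ʳ; shift; shifts; ↭-length)
open import Data.List.Sort ≤-decTotalOrder using (sort; sort-↭; sort-↗)
open import Data.List.Relation.Unary.Linked using ([-]; _∷_)
open import Data.Product using (∃; ∃₂; _×_; _,_; proj₁; proj₂)
open import Data.Sum using (_⊎_; inj₁; inj₂; [_,_]′)
import Data.Sum as Sum
open import Data.Unit using (⊤; tt)
open import Function using (id; _∘_; _⇔_; mk⇔; Equivalence)
open import Function.Properties.Equivalence using () renaming (sym to ⇔-sym; trans to ⇔-trans)
open import Relation.Binary.PropositionalEquality
open import Relation.Nullary using (¬_; Dec; yes; no; contradiction)
open import Relation.Nullary.Decidable using (_×-dec_; map′)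

module _ {X : Set} where

  open import Data.List.Relation.Binary.Permutation.Setoid.Properties (setoid X)
    using () renaming (Unique-resp-↭ to Unique-resp-↭ₛ)

  Unique-resp-↭ : ∀ {xs ys : List X} → xs ↭ ys → Unique xs → Unique ys
  Unique-resp-↭ = Unique-resp-↭ₛ ∘ ↭⇒↭ₛ

  enumeration⇔↭ : ∀ {P : X → Set} {xs ws : List X} → Unique xs → (∀ e → P e ⇔ e ∈ xs) →
                  (Unique ws × (∀ e → e ∈ ws ⇔ P e)) ⇔ (ws ↭ xs)
  enumeration⇔↭ {P} {xs} {ws} uxs P⇔∈xs = mk⇔ to from
    where
    to : Unique ws × (∀ e → e ∈ ws ⇔ P e) → ws ↭ xs
    to (uws , ∈ws⇔P) = ∼bag⇒↭ (unique∧set⇒bag uws uxs (λ {e} → ⇔-trans (∈ws⇔P e) (P⇔∈xs e)))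

    from : ws ↭ xs → Unique ws × (∀ e → e ∈ ws ⇔ P e)
    from ws↭xs = Unique-resp-↭ (↭-sym ws↭xs) uxs , λ e →
      ⇔-trans (mk⇔ (∈-resp-↭ ws↭xs) (∈-resp-↭ (↭-sym ws↭xs))) (⇔-sym (P⇔∈xs e))

  Unique-++⁻ʳ : ∀ (p : List X) {l} → Unique (p ++ l) → Unique l
  Unique-++⁻ʳ []      u       = u
  Unique-++⁻ʳ (_ ∷ p) (_ ∷ u) = Unique-++⁻ʳ p u

sorted-triple : ∀ {x y z} → Unique (x ∷ y ∷ z ∷ []) →
                ∃₂ λ p q → ∃ λ r → p < q × q < r × x ∷ y ∷ z ∷ [] ↭ p ∷ q ∷ r ∷ []
sorted-triple {x} {y} {z} u
  with sort (x ∷ y ∷ z ∷ []) | sort-↭ (x ∷ y ∷ z ∷ []) | sort-↗ (x ∷ y ∷ z ∷ [])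
     | ↭-length (sort-↭ (x ∷ y ∷ z ∷ []))
... | [] | _ | _ | ()
... | _ ∷ [] | _ | _ | ()
... | _ ∷ _ ∷ [] | _ | _ | ()
... | _ ∷ _ ∷ _ ∷ _ ∷ _ | _ | _ | ()
... | p ∷ q ∷ r ∷ [] | pqr↭xyz | p≤q ∷ q≤r ∷ [-] | _
  with Unique-resp-↭ (↭-sym pqr↭xyz) u
...   | (p≢q ∷ _) ∷ (q≢r ∷ []) ∷ [] ∷ [] =
        p , q , r , ≤∧≢⇒< p≤q p≢q , ≤∧≢⇒< q≤r q≢r , ↭-sym pqr↭xyz

interval : ℕ → ℕ → List ℕ
interval s zero    = []
interval s (suc k) = suc s ∷ interval (suc s) k

length-interval : ∀ s k → length (interval s k) ≡ k
length-interval s zero    = refl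
length-interval s (suc k) = cong suc (length-interval (suc s) k)

∈-interval⁻ : ∀ {s k e} → e ∈ interval s k → s < e × e ≤ s + k
∈-interval⁻ {s} {suc k} (here refl) = n<1+n s , subst (suc s ≤_) (sym (+-suc s k)) (s≤s (m≤m+n s k))
∈-interval⁻ {s} {suc k} {e} (there e∈) with ∈-interval⁻ e∈
... | s+1<e , e≤s+1+k = <-trans (n<1+n s) s+1<e , subst (e ≤_) (sym (+-suc s k)) e≤s+1+k

∈-interval⁺ : ∀ {s k e} → s < e → e ≤ s + k → e ∈ interval s k
∈-interval⁺ {s} {zero}  s<e e≤s+0 = contradiction (subst (_ ≤_) (+-identityʳ s) e≤s+0) (<⇒≱ s<e)
∈-interval⁺ {s} {suc k} {e} s<e e≤s+k with suc s ≟ e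
... | yes refl = here refl
... | no s+1≢e = there (∈-interval⁺ (≤∧≢⇒< s<e s+1≢e) (subst (e ≤_) (+-suc s k) e≤s+k))

interval-unique : ∀ s k → Unique (interval s k)
interval-unique s zero    = []
interval-unique s (suc k) =
  All.tabulate (λ e∈ → <⇒≢ (proj₁ (∈-interval⁻ e∈))) ∷ interval-unique (suc s) k

interval-++ : ∀ s k l → interval s k ++ interval (s + k) l ≡ interval s (k + l)
interval-++ s zero    l = cong (λ t → interval t l) (+-identityʳ s)
interval-++ s (suc k) l = cong (suc s ∷_)
  (trans (cong (λ t → interval (suc s) k ++ interval t l) (+-suc s k)) (interval-++ (suc s) k l))

interval-split : ∀ {s t u} → s ≤ t → t ≤ u → interval s (u ∸ s) ≡ interval s (t ∸ s) ++ interval t (u ∸ t)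
interval-split {s} {t} {u} s≤t t≤u = begin
  interval s (u ∸ s)                                   ≡⟨ cong (interval s) u∸s≡ ⟩
  interval s ((t ∸ s) + (u ∸ t))                       ≡⟨ interval-++ s (t ∸ s) (u ∸ t) ⟨
  interval s (t ∸ s) ++ interval (s + (t ∸ s)) (u ∸ t)
    ≡⟨ cong (λ v → interval s (t ∸ s) ++ interval v (u ∸ t)) (m+[n∸m]≡n s≤t) ⟩
  interval s (t ∸ s) ++ interval t (u ∸ t)             ∎
  where
  open ≡-Reasoning
  u∸s≡ : u ∸ s ≡ (t ∸ s) + (u ∸ t)
  u∸s≡ = trans (cong (_∸ s) (sym (m+[n∸m]≡n t≤u))) (+-∸-comm (u ∸ t) s≤t)

map-interval : ∀ {Y : Set} {f : ℕ → Y} {y s} k → (∀ {e} → e ∈ interval s k → f e ≡ y) →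
               map f (interval s k) ≡ replicate k y
map-interval zero    _    = refl
map-interval (suc k) f≡y = cong₂ _∷_ (f≡y (here refl)) (map-interval k (f≡y ∘ there))

weave : ℕ → ℕ → ℕ → List ℕ
weave s t zero    = []
weave s t (suc k) = suc s ∷ suc t ∷ suc (suc t) ∷ weave (suc s) (suc (suc t)) k

weave-↭ : ∀ s t k → weave s t k ↭ interval s k ++ interval t (k * 2)
weave-↭ s t zero    = ↭-refl
weave-↭ s t (suc k) = prep (suc s) (↭-trans (prep u (prep v (weave-↭ (suc s) (suc (suc t)) k)))
  (↭-sym (↭-trans (shift u S (v ∷ T)) (prep u (shift v S T)))))
  where
  u = suc t
  v = suc (suc t)
  S = interval (suc s) k
  T = interval (suc (suc t)) (k * 2)

AllWindows : {X : Set} → (X → X → X → Set) → List X → Set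
AllWindows P (x ∷ y ∷ z ∷ xs) = P x y z × AllWindows P (y ∷ z ∷ xs)
AllWindows P _                = ⊤

allWindows-tail : ∀ {X : Set} {P : X → X → X → Set} {x xs} → AllWindows P (x ∷ xs) → AllWindows P xs
allWindows-tail {xs = []}              _       = tt
allWindows-tail {xs = _ ∷ []}          _       = tt
allWindows-tail {xs = _ ∷ _ ∷ _}       (_ , h) = h

allWindows-++⁻ʳ : ∀ {X : Set} {P : X → X → X → Set} p {xs} → AllWindows P (p ++ xs) → AllWindows P xs
allWindows-++⁻ʳ []      h = h
allWindows-++⁻ʳ (_ ∷ p) h = allWindows-++⁻ʳ p (allWindows-tail h)

allWindows-map⁺ : ∀ {X Y : Set} {P : Y → Y → Y → Set} {f : X → Y} xs →
                  AllWindows (λ x y z → P (f x) (f y) (f z)) xs → AllWindows P (map f xs)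
allWindows-map⁺ (x ∷ y ∷ z ∷ xs) (pxyz , h) = pxyz , allWindows-map⁺ (y ∷ z ∷ xs) h
allWindows-map⁺ []                _         = tt
allWindows-map⁺ (_ ∷ [])          _         = tt
allWindows-map⁺ (_ ∷ _ ∷ [])      _         = tt

allWindows-map⁻ : ∀ {X Y : Set} {P : Y → Y → Y → Set} {f : X → Y} xs →
                  AllWindows P (map f xs) → AllWindows (λ x y z → P (f x) (f y) (f z)) xs
allWindows-map⁻ (x ∷ y ∷ z ∷ xs) (pxyz , h) = pxyz , allWindows-map⁻ (y ∷ z ∷ xs) h
allWindows-map⁻ []                _         = tt
allWindows-map⁻ (_ ∷ [])          _         = tt
allWindows-map⁻ (_ ∷ _ ∷ [])      _         = tt

hasConsecutiveBasis-∷ : ∀ {P x w} → HasConsecutiveBasis P w → HasConsecutiveBasis P (x ∷ w)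
hasConsecutiveBasis-∷ {x = x} (p , y , z , v , r , w≡ , b) = x ∷ p , y , z , v , r , cong (x ∷_) w≡ , b

consecutive⊎allWindows : ∀ {P : Bases₃} → (∀ x y z → Dec (P x y z)) → ∀ w →
                         HasConsecutiveBasis P w ⊎ AllWindows (λ x y z → ¬ P x y z) w
consecutive⊎allWindows P? []           = inj₂ tt
consecutive⊎allWindows P? (_ ∷ [])     = inj₂ tt
consecutive⊎allWindows P? (_ ∷ _ ∷ []) = inj₂ tt
consecutive⊎allWindows P? (x ∷ w@(y ∷ z ∷ r)) with P? x y z | consecutive⊎allWindows P? w
... | yes pxyz | _    = inj₁ ([] , x , y , z , r , refl , pxyz)
... | no ¬pxyz | rest = Sum.map hasConsecutiveBasis-∷ (¬pxyz ,_) rest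

sum-map-↭ : ∀ {X : Set} (f : X → ℕ) {xs ys} → xs ↭ ys → sum (map f xs) ≡ sum (map f ys)
sum-map-↭ f = sum-↭ ∘ map⁺ f

sum-map-++ : ∀ {X : Set} (f : X → ℕ) xs {ys} → sum (map f (xs ++ ys)) ≡ sum (map f xs) + sum (map f ys)
sum-map-++ f xs {ys} = trans (cong sum (map-++ f xs ys)) (sum-++ (map f xs) (map f ys))

sum-map-replicate : ∀ {X : Set} (f : X → ℕ) k {x} → sum (map f (replicate k x)) ≡ k * f x
sum-map-replicate f zero    = refl
sum-map-replicate f (suc k) = cong (f _ +_) (sum-map-replicate f k)

sum-map-≡0 : ∀ {X : Set} (f : X → ℕ) {xs} → All (λ x → f x ≡ 0) xs → sum (map f xs) ≡ 0
sum-map-≡0 f []           = refl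
sum-map-≡0 f (fx≡0 ∷ h) = cong₂ _+_ fx≡0 (sum-map-≡0 f h)

data Label : Set where
  A B C : Label

χA χB χC χAB : Label → ℕ
χA A = 1
χA _ = 0
χB B = 1
χB _ = 0
χC C = 1
χC _ = 0
χAB C = 0
χAB _ = 1

χAB≤1 : ∀ ℓ → χAB ℓ ≤ 1
χAB≤1 A = ≤-refl
χAB≤1 B = ≤-refl
χAB≤1 C = z≤n

#A #B #C #AB : List Label → ℕ
#A  ws = sum (map χA ws)
#B  ws = sum (map χB ws)
#C  ws = sum (map χC ws)
#AB ws = sum (map χAB ws)

record Good (x y z : Label) : Set where
  constructor counts
  field
    oneA  : 1 ≤ #A  (x ∷ y ∷ z ∷ [])
    twoAB : 2 ≤ #AB (x ∷ y ∷ z ∷ [])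

pattern good = counts (s≤s z≤n) (s≤s (s≤s z≤n))

good? : ∀ x y z → Dec (Good x y z)
good? x y z = map′ (λ (p , q) → counts p q) (λ (counts p q) → p , q)
  (1 ≤? #A (x ∷ y ∷ z ∷ []) ×-dec 2 ≤? #AB (x ∷ y ∷ z ∷ []))

good-resp-↭ : ∀ {x y z x′ y′ z′} → x ∷ y ∷ z ∷ [] ↭ x′ ∷ y′ ∷ z′ ∷ [] → Good x y z → Good x′ y′ z′
good-resp-↭ p (counts 1≤#A 2≤#AB) =
  counts (subst (1 ≤_) (sum-map-↭ χA p) 1≤#A) (subst (2 ≤_) (sum-map-↭ χAB p) 2≤#AB)

good-∷ : ∀ {x y z} → Good y z C → Good x y z
good-∷ {x} (counts 1≤#A 2≤#AB) =
  counts (≤-trans 1≤#A (m≤n+m _ (χA x))) (≤-trans 2≤#AB (m≤n+m _ (χAB x)))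

¬Good-A⇒CC : ∀ x y → ¬ Good A x y → x ≡ C × y ≡ C
¬Good-A⇒CC A _ bad = contradiction good bad
¬Good-A⇒CC B _ bad = contradiction good bad
¬Good-A⇒CC C A bad = contradiction good bad
¬Good-A⇒CC C B bad = contradiction good bad
¬Good-A⇒CC C C _   = refl , refl

¬Good-CC : ∀ x → ¬ Good C C x
¬Good-CC A (counts _ (s≤s ()))
¬Good-CC B (counts _ (s≤s ()))
¬Good-CC C (counts _ ())

¬Good-A-free : ∀ {x y z} → All (λ ℓ → χA ℓ ≡ 0) (x ∷ y ∷ z ∷ []) → ¬ Good x y z
¬Good-A-free noA (counts 1≤#A _) = n≮0 (subst (1 ≤_) (sum-map-≡0 χA noA) 1≤#A)

NoGoodWindow : List Label → Set
NoGoodWindow = AllWindows (λ x y z → ¬ Good x y z)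

-- Padding with a C lets the counting lemmas below treat the last letters like inner ones. The
-- length condition matters: A ∷ B ∷ [] has no window, but A ∷ B ∷ C ∷ [] is a good one.
noGoodWindow-∷ʳ : ∀ ws → 3 ≤ length ws → NoGoodWindow ws → NoGoodWindow (ws ∷ʳ C)
noGoodWindow-∷ʳ (x ∷ y ∷ z ∷ [])         _ (bad , _) = bad , bad ∘ good-∷ , tt
noGoodWindow-∷ʳ (x ∷ ws@(_ ∷ _ ∷ _ ∷ _)) _ (bad , h) = bad , noGoodWindow-∷ʳ ws (s≤s (s≤s (s≤s z≤n))) h
noGoodWindow-∷ʳ (_ ∷ [])     (s≤s ())
noGoodWindow-∷ʳ (_ ∷ _ ∷ []) (s≤s (s≤s ()))

noGoodWindow-A-free : ∀ {ws} → All (λ ℓ → χA ℓ ≡ 0) ws → NoGoodWindow ws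
noGoodWindow-A-free []                    = tt
noGoodWindow-A-free (_ ∷ [])              = tt
noGoodWindow-A-free (_ ∷ _ ∷ [])          = tt
noGoodWindow-A-free (hx ∷ h@(hy ∷ hz ∷ _)) = ¬Good-A-free (hx ∷ hy ∷ hz ∷ []) , noGoodWindow-A-free h

noGoodWindow-CC∷ : ∀ {ws} → NoGoodWindow (C ∷ ws) → NoGoodWindow (C ∷ C ∷ ws)
noGoodWindow-CC∷ {[]}    _ = tt
noGoodWindow-CC∷ {x ∷ _} h = ¬Good-CC x , h

ACC : ℕ → List Label
ACC zero    = []
ACC (suc k) = A ∷ C ∷ C ∷ ACC k

map-weave : ∀ {f : ℕ → Label} {s t} k → (∀ {e} → e ∈ interval s k → f e ≡ A) →
            (∀ {e} → e ∈ interval t (k * 2) → f e ≡ C) → map f (weave s t k) ≡ ACC k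
map-weave zero    _   _   = refl
map-weave (suc k) f≡A f≡C = cong₂ _∷_ (f≡A (here refl)) (cong₂ _∷_ (f≡C (here refl))
  (cong₂ _∷_ (f≡C (there (here refl))) (map-weave k (f≡A ∘ there) (f≡C ∘ there ∘ there))))

noGoodWindow-C∷ACC : ∀ k {ws} → All (λ ℓ → χA ℓ ≡ 0) ws → NoGoodWindow (C ∷ ACC k ++ ws)
noGoodWindow-C∷ACC zero    noA = noGoodWindow-A-free (refl ∷ noA)
noGoodWindow-C∷ACC (suc k) noA =
  (λ { (counts _ (s≤s ())) }) , (λ { (counts _ (s≤s ())) }) , noGoodWindow-CC∷ (noGoodWindow-C∷ACC k noA)

#A*2≤#C+2 : ∀ ws → NoGoodWindow (ws ∷ʳ C) → #A ws * 2 ≤ #C ws + 2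
#A*2≤#C+2 []      _ = z≤n
#A*2≤#C+2 (A ∷ []) _ = ≤-refl
#A*2≤#C+2 (A ∷ x ∷ []) (bad , _) with ¬Good-A⇒CC x C bad
... | refl , _ = n≤1+n 2
#A*2≤#C+2 (A ∷ x ∷ y ∷ ws) (bad , h) with ¬Good-A⇒CC x y bad
... | refl , refl = s≤s (s≤s (#A*2≤#C+2 ws (allWindows-++⁻ʳ (C ∷ C ∷ []) h)))
#A*2≤#C+2 (B ∷ ws) h = #A*2≤#C+2 ws (allWindows-tail h)
#A*2≤#C+2 (C ∷ ws) h = m≤n⇒m≤1+n (#A*2≤#C+2 ws (allWindows-tail h))

#A*2≤#C-afterB : ∀ ws → NoGoodWindow (B ∷ ws ∷ʳ C) → #A ws * 2 ≤ #C ws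
#A*2≤#C-afterB []           _         = z≤n
#A*2≤#C-afterB (A ∷ [])     (bad , _) = contradiction good bad
#A*2≤#C-afterB (A ∷ _ ∷ _)  (bad , _) = contradiction good bad
#A*2≤#C-afterB (B ∷ ws)     h         = #A*2≤#C-afterB ws (allWindows-tail h)
#A*2≤#C-afterB (C ∷ [])     _         = z≤n
#A*2≤#C-afterB (C ∷ A ∷ _)  (bad , _) = contradiction good bad
#A*2≤#C-afterB (C ∷ B ∷ ws) h         =
  m≤n⇒m≤1+n (#A*2≤#C-afterB ws (allWindows-++⁻ʳ (B ∷ C ∷ []) h))
#A*2≤#C-afterB (C ∷ C ∷ ws) h         =
  subst (#A ws * 2 ≤_) (+-comm _ 2) (#A*2≤#C+2 ws (allWindows-++⁻ʳ (B ∷ C ∷ C ∷ []) h))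

#A*2≤#C : ∀ ws → 0 < #B ws → NoGoodWindow (ws ∷ʳ C) → #A ws * 2 ≤ #C ws
#A*2≤#C (A ∷ x ∷ []) 0<#B (bad , _) with ¬Good-A⇒CC x C bad
... | refl , _ = contradiction 0<#B n≮0
#A*2≤#C (A ∷ x ∷ y ∷ ws) 0<#B (bad , h) with ¬Good-A⇒CC x y bad
... | refl , refl = s≤s (s≤s (#A*2≤#C ws 0<#B (allWindows-++⁻ʳ (C ∷ C ∷ []) h)))
#A*2≤#C (B ∷ ws) _    h = #A*2≤#C-afterB ws h
#A*2≤#C (C ∷ ws) 0<#B h = m≤n⇒m≤1+n (#A*2≤#C ws 0<#B (allWindows-tail h))

m*n≤o⇔m≤o/n : ∀ m n o .{{_ : NonZero n}} → m * n ≤ o ⇔ m ≤ o / n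
m*n≤o⇔m≤o/n m n o = mk⇔ (λ m*n≤o → subst (_≤ o / n) (m*n/n≡m m n) (/-monoˡ-≤ n m*n≤o))
                         (λ m≤o/n → ≤-trans (*-monoˡ-≤ n m≤o/n) (m/n*n≤m o n))

module Shifted (n a b c : ℕ) (1≤a : 1 ≤ a) (a<b : a < b) (b<c : b < c) (c≤n : c ≤ n) where

  SB : Bases₃
  SB = ShiftedBasis n a b c

  nonLoops : List ℕ
  nonLoops = interval 0 c

  a≤b : a ≤ b
  a≤b = <⇒≤ a<b

  b≤c : b ≤ c
  b≤c = <⇒≤ b<c

  label : ℕ → Label
  label e with e ≤? a | e ≤? b
  ... | yes _ | _     = A
  ... | no _  | yes _ = B
  ... | no _  | no _  = C

  label-A : ∀ {e} → e ≤ a → label e ≡ A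
  label-A {e} e≤a with e ≤? a
  ... | yes _  = refl
  ... | no e≰a = contradiction e≤a e≰a

  label-B : ∀ {e} → a < e → e ≤ b → label e ≡ B
  label-B {e} a<e e≤b with e ≤? a | e ≤? b
  ... | yes e≤a | _      = contradiction e≤a (<⇒≱ a<e)
  ... | no _    | yes _  = refl
  ... | no _    | no e≰b = contradiction e≤b e≰b

  label-C : ∀ {e} → b < e → label e ≡ C
  label-C {e} b<e with e ≤? a | e ≤? b
  ... | yes e≤a | _       = contradiction (≤-trans e≤a a≤b) (<⇒≱ b<e)
  ... | no _    | yes e≤b = contradiction e≤b (<⇒≱ b<e)
  ... | no _    | no _    = refl

  label≢C : ∀ {e} → e ≤ b → label e ≢ C
  label≢C {e} e≤b with e ≤? a | e ≤? b
  ... | yes _ | _      = λ ()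
  ... | no _  | yes _  = λ ()
  ... | no _  | no e≰b = contradiction e≤b e≰b

  χA-label : ∀ {e} → a < e → χA (label e) ≡ 0
  χA-label {e} a<e = [ (λ e≤b → cong χA (label-B a<e e≤b)) , (λ b<e → cong χA (label-C b<e)) ]′
                        (≤-<-connex e b)

  χAB-label : ∀ {e} → b < e → χAB (label e) ≡ 0
  χAB-label b<e = cong χAB (label-C b<e)

  label-∈A : ∀ {e} → e ∈ interval 0 a → label e ≡ A
  label-∈A = label-A ∘ proj₂ ∘ ∈-interval⁻

  label-∈B : ∀ {e} → e ∈ interval a (b ∸ a) → label e ≡ B
  label-∈B e∈ with ∈-interval⁻ e∈
  ... | a<e , e≤a+[b∸a] = label-B a<e (subst (_ ≤_) (m+[n∸m]≡n a≤b) e≤a+[b∸a])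

  label-∈C : ∀ {s k e} → b ≤ s → e ∈ interval s k → label e ≡ C
  label-∈C b≤s e∈ = label-C (≤-<-trans b≤s (proj₁ (∈-interval⁻ e∈)))

  GoodLabels : Bases₃
  GoodLabels x y z = Good (label x) (label y) (label z)

  goodLabels? : ∀ x y z → Dec (GoodLabels x y z)
  goodLabels? x y z = good? (label x) (label y) (label z)

  mkBasis : ∀ {x y z p q r} → 1 ≤ p → p < q → q < r → r ≤ c → p ≤ a → q ≤ b →
            x ∷ y ∷ z ∷ [] ↭ p ∷ q ∷ r ∷ [] → SB x y z
  mkBasis {p = p} {q} {r} 1≤p p<q q<r r≤c p≤a q≤b xyz↭pqr =
    p , q , r , 1≤p , p<q , q<r , ≤-trans r≤c c≤n , p≤a , q≤b , r≤c , xyz↭pqr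

  basis⇒range : ∀ {x y z} → SB x y z → All (_∈ nonLoops) (x ∷ y ∷ z ∷ [])
  basis⇒range (p , q , r , 1≤p , p<q , q<r , _ , _ , _ , r≤c , xyz↭pqr) =
    All-resp-↭ (↭-sym xyz↭pqr) (∈-interval⁺ 1≤p (<⇒≤ (<-≤-trans p<r r≤c)) ∷
      ∈-interval⁺ (≤-trans 1≤p (<⇒≤ p<q)) (<⇒≤ (<-≤-trans q<r r≤c)) ∷
      ∈-interval⁺ (≤-trans 1≤p (<⇒≤ p<r)) r≤c ∷ [])
    where p<r = <-trans p<q q<r

  bounds⇒good : ∀ {p q r} → p ≤ a → q ≤ b → GoodLabels p q r
  bounds⇒good {p} {q} p≤a q≤b rewrite label-A p≤a with label q | label≢C q≤b
  ... | A | _   = good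
  ... | B | _   = good
  ... | C | q≢C = contradiction refl q≢C

  good⇒bounds : ∀ {p q r} → p ≤ q → q ≤ r → GoodLabels p q r → p ≤ a × q ≤ b
  good⇒bounds {p} {q} {r} p≤q q≤r (counts 1≤#A 2≤#AB) =
    ≮⇒≥ (λ a<p → n≮0 (subst (1 ≤_) (#A≡0 a<p) 1≤#A)) ,
    ≮⇒≥ (λ b<q → 1+n≰n (≤-trans 2≤#AB (+-mono-≤ (χAB≤1 (label p)) (≤-reflexive (#AB≡0 b<q)))))
    where
    #A≡0 : a < p → #A (label p ∷ label q ∷ label r ∷ []) ≡ 0
    #A≡0 a<p = sum-map-≡0 χA (χA-label a<p ∷ χA-label (<-≤-trans a<p p≤q) ∷
                           χA-label (<-≤-trans a<p (≤-trans p≤q q≤r)) ∷ [])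
    #AB≡0 : b < q → #AB (label q ∷ label r ∷ []) ≡ 0
    #AB≡0 b<q = sum-map-≡0 χAB (χAB-label b<q ∷ χAB-label (<-≤-trans b<q q≤r) ∷ [])

  basis⇒good : ∀ {x y z} → SB x y z → GoodLabels x y z
  basis⇒good (_ , _ , _ , _ , _ , _ , _ , p≤a , q≤b , _ , xyz↭pqr) =
    good-resp-↭ (↭-sym (map⁺ label xyz↭pqr)) (bounds⇒good p≤a q≤b)

  good⇒basis : ∀ {x y z} → Unique (x ∷ y ∷ z ∷ []) → All (_∈ nonLoops) (x ∷ y ∷ z ∷ []) →
               GoodLabels x y z → SB x y z
  good⇒basis xyz-unique xyz∈ g with sorted-triple xyz-unique
  ... | p , q , r , p<q , q<r , xyz↭pqr
    with All-resp-↭ xyz↭pqr xyz∈ | good⇒bounds (<⇒≤ p<q) (<⇒≤ q<r) (good-resp-↭ (map⁺ label xyz↭pqr) g)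
  ... | p∈ ∷ _ ∷ r∈ ∷ [] | p≤a , q≤b =
        mkBasis (proj₁ (∈-interval⁻ p∈)) p<q q<r (proj₂ (∈-interval⁻ r∈)) p≤a q≤b xyz↭pqr

  nonLoop-partners : ∀ {e} → 1 ≤ e → e ≤ c → ∃₂ λ y z → SB e y z
  nonLoop-partners {e} 1≤e e≤c with e ≤? a | e ≤? b
  ... | yes e≤a | _       = b , c , mkBasis 1≤e (≤-<-trans e≤a a<b) b<c ≤-refl e≤a ≤-refl ↭-refl
  ... | no e≰a  | yes e≤b = a , c , mkBasis 1≤a (≰⇒> e≰a) (≤-<-trans e≤b b<c) ≤-refl ≤-refl e≤b
                                      (swap e a ↭-refl)
  ... | no _    | no e≰b  = a , b , mkBasis 1≤a a<b (≰⇒> e≰b) e≤c ≤-refl ≤-refl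
                                      (↭-trans (swap e a ↭-refl) (prep a (swap e b ↭-refl)))

  nonLoop⇔ : ∀ {e} → NonLoop n SB e ⇔ e ∈ nonLoops
  nonLoop⇔ = mk⇔ (λ (_ , _ , _ , _ , sb) → All.head (basis⇒range sb))
                  (λ e∈ → let 1≤e , e≤c = ∈-interval⁻ e∈ in
                          1≤e , ≤-trans e≤c c≤n , nonLoop-partners 1≤e e≤c)

  isOrdering⇔↭ : ∀ {w} → IsOrderingOfNonLoops n SB w ⇔ (w ↭ nonLoops)
  isOrdering⇔↭ = enumeration⇔↭ (interval-unique 0 c) (λ _ → nonLoop⇔)

  nonLoops-blocks : nonLoops ≡ interval 0 a ++ (interval a (b ∸ a) ++ interval b (c ∸ b))
  nonLoops-blocks = trans (interval-split z≤n (≤-trans a≤b b≤c)) (cong (interval 0 a ++_) (interval-split a≤b b≤c))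

  labels-of-nonLoops : map label nonLoops ≡ replicate a A ++ (replicate (b ∸ a) B ++ replicate (c ∸ b) C)
  labels-of-nonLoops = begin
    map label nonLoops                                                     ≡⟨ cong (map label) nonLoops-blocks ⟩
    map label (interval 0 a ++ (interval a (b ∸ a) ++ interval b (c ∸ b))) ≡⟨ map-++ label (interval 0 a) _ ⟩
    map label (interval 0 a) ++ map label (interval a (b ∸ a) ++ interval b (c ∸ b))
      ≡⟨ cong (map label (interval 0 a) ++_) (map-++ label (interval a (b ∸ a)) _) ⟩
    map label (interval 0 a) ++ (map label (interval a (b ∸ a)) ++ map label (interval b (c ∸ b)))
      ≡⟨ cong₂ _++_ (map-interval a label-∈A)
                    (cong₂ _++_ (map-interval (b ∸ a) label-∈B) (map-interval (c ∸ b) (label-∈C ≤-refl))) ⟩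
    replicate a A ++ (replicate (b ∸ a) B ++ replicate (c ∸ b) C)          ∎
    where open ≡-Reasoning

  count-ordering : ∀ (f : Label → ℕ) {w} → w ↭ nonLoops →
                   sum (map f (map label w)) ≡ a * f A + ((b ∸ a) * f B + (c ∸ b) * f C)
  count-ordering f {w} w↭ = begin
    sum (map f (map label w))        ≡⟨ sum-map-↭ f (map⁺ label w↭) ⟩
    sum (map f (map label nonLoops)) ≡⟨ cong (sum ∘ map f) labels-of-nonLoops ⟩
    sum (map f (replicate a A ++ (replicate (b ∸ a) B ++ replicate (c ∸ b) C)))
      ≡⟨ sum-map-++ f (replicate a A) ⟩
    sum (map f (replicate a A)) + sum (map f (replicate (b ∸ a) B ++ replicate (c ∸ b) C))
      ≡⟨ cong (sum (map f (replicate a A)) +_) (sum-map-++ f (replicate (b ∸ a) B)) ⟩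
    sum (map f (replicate a A)) + (sum (map f (replicate (b ∸ a) B)) + sum (map f (replicate (c ∸ b) C)))
      ≡⟨ cong₂ _+_ (sum-map-replicate f a) (cong₂ _+_ (sum-map-replicate f (b ∸ a)) (sum-map-replicate f (c ∸ b))) ⟩
    a * f A + ((b ∸ a) * f B + (c ∸ b) * f C) ∎
    where open ≡-Reasoning

  noGoodWindow⇒a*2≤c∸b : ∀ {w} → w ↭ nonLoops → NoGoodWindow (map label w) → a * 2 ≤ c ∸ b
  noGoodWindow⇒a*2≤c∸b {w} w↭ noGood =
    subst₂ _≤_ (cong (_* 2) #A≡a) #C≡c∸b
      (#A*2≤#C (map label w) 0<#B (noGoodWindow-∷ʳ (map label w) 3≤length noGood))
    where
    #A≡a : #A (map label w) ≡ a
    #A≡a = trans (count-ordering χA w↭)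
      (trans (cong₂ _+_ (*-identityʳ a) (cong₂ _+_ (*-zeroʳ (b ∸ a)) (*-zeroʳ (c ∸ b)))) (+-identityʳ a))
    #C≡c∸b : #C (map label w) ≡ c ∸ b
    #C≡c∸b = trans (count-ordering χC w↭)
      (cong₂ _+_ (*-zeroʳ a) (cong₂ _+_ (*-zeroʳ (b ∸ a)) (*-identityʳ (c ∸ b))))
    0<#B : 0 < #B (map label w)
    0<#B = subst (0 <_) (sym (trans (count-ordering χB w↭)
      (trans (cong₂ _+_ (*-zeroʳ a) (cong₂ _+_ (*-identityʳ (b ∸ a)) (*-zeroʳ (c ∸ b)))) (+-identityʳ (b ∸ a)))))
      (m<n⇒0<n∸m a<b)
    3≤length : 3 ≤ length (map label w)
    3≤length = subst (3 ≤_) (sym (trans (length-map label w) (trans (↭-length w↭) (length-interval 0 c))))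
      (≤-trans (s≤s (s≤s 1≤a)) (≤-trans (s≤s a<b) b<c))

  ordering⊆nonLoops : ∀ {w} → IsOrderingOfNonLoops n SB w → All (_∈ nonLoops) w
  ordering⊆nonLoops (_ , ∈w⇔nonLoop) =
    All.tabulate λ {e} e∈w → Equivalence.to nonLoop⇔ (Equivalence.to (∈w⇔nonLoop e) e∈w)

  consecutiveBasis⊎a*2≤c∸b : ∀ w → IsOrderingOfNonLoops n SB w → HasConsecutiveBasis SB w ⊎ a * 2 ≤ c ∸ b
  consecutiveBasis⊎a*2≤c∸b w ord@(w-unique , _) with consecutive⊎allWindows goodLabels? w
  ... | inj₂ noGood = inj₂ (noGoodWindow⇒a*2≤c∸b (Equivalence.to isOrdering⇔↭ ord) (allWindows-map⁺ w noGood))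
  ... | inj₁ (p , x , y , z , r , w≡ , g) = inj₁ (p , x , y , z , r , w≡ , good⇒basis xyz-unique xyz∈ g)
    where
    xyz-unique = Unique.take⁺ 3 (Unique-++⁻ʳ p (subst Unique w≡ w-unique))
    xyz∈       = All.take⁺ 3 (All.++⁻ʳ p (subst (All (_∈ nonLoops)) w≡ (ordering⊆nonLoops ord)))

  module SparseOrdering (a*2≤c∸b : a * 2 ≤ c ∸ b) where

    m : ℕ
    m = (c ∸ b) ∸ a * 2

    Bs Cs : List ℕ
    Bs = interval a (b ∸ a)
    Cs = interval (b + a * 2) m

    W : List ℕ
    W = weave 0 b a ++ (Bs ++ Cs)

    W↭ : W ↭ nonLoops
    W↭ = begin
      weave 0 b a ++ (Bs ++ Cs)                          ↭⟨ ++⁺ʳ (Bs ++ Cs) (weave-↭ 0 b a) ⟩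
      (interval 0 a ++ interval b (a * 2)) ++ (Bs ++ Cs) ≡⟨ ++-assoc (interval 0 a) _ _ ⟩
      interval 0 a ++ (interval b (a * 2) ++ (Bs ++ Cs)) ↭⟨ ++⁺ˡ (interval 0 a) (shifts (interval b (a * 2)) Bs) ⟩
      interval 0 a ++ (Bs ++ (interval b (a * 2) ++ Cs)) ≡⟨ cong (λ xs → interval 0 a ++ (Bs ++ xs)) C-blocks ⟩
      interval 0 a ++ (Bs ++ interval b (c ∸ b))         ≡⟨ nonLoops-blocks ⟨
      nonLoops                                           ∎
      where
      open PermutationReasoning
      C-blocks : interval b (a * 2) ++ Cs ≡ interval b (c ∸ b)
      C-blocks = trans (interval-++ b (a * 2) m) (cong (interval b) (m+[n∸m]≡n a*2≤c∸b))

    labels-of-W : map label W ≡ ACC a ++ (replicate (b ∸ a) B ++ replicate m C)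
    labels-of-W = begin
      map label (weave 0 b a ++ (Bs ++ Cs))                      ≡⟨ map-++ label (weave 0 b a) _ ⟩
      map label (weave 0 b a) ++ map label (Bs ++ Cs)
        ≡⟨ cong (map label (weave 0 b a) ++_) (map-++ label Bs Cs) ⟩
      map label (weave 0 b a) ++ (map label Bs ++ map label Cs)
        ≡⟨ cong₂ _++_ (map-weave a label-∈A (label-∈C ≤-refl))
                      (cong₂ _++_ (map-interval (b ∸ a) label-∈B) (map-interval m (label-∈C (m≤m+n b (a * 2))))) ⟩
      ACC a ++ (replicate (b ∸ a) B ++ replicate m C)            ∎
      where open ≡-Reasoning

    noGoodWindow-W : NoGoodWindow (map label W)
    noGoodWindow-W = subst NoGoodWindow (sym labels-of-W)
      (allWindows-tail (noGoodWindow-C∷ACC a (All.++⁺ (All.replicate⁺ (b ∸ a) refl) (All.replicate⁺ m refl))))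

    ¬DJS : ¬ DJS n SB
    ¬DJS djs with djs W (Equivalence.from isOrdering⇔↭ W↭)
    ... | p , x , y , z , r , W≡ , sb =
      proj₁ (allWindows-++⁻ʳ p (subst (AllWindows λ x y z → ¬ GoodLabels x y z) W≡
                                      (allWindows-map⁻ W noGoodWindow-W))) (basis⇒good sb)

proposition6p8 : (n a b c : ℕ) → 1 ≤ a → a < b → b < c → c ≤ n →
    DJS n (ShiftedBasis n a b c) ⇔ ((c ∸ b) / 2 < a)
proposition6p8 n a b c 1≤a a<b b<c c≤n = mk⇔
  (λ djs → ≰⇒> λ a≤[c∸b]/2 → SparseOrdering.¬DJS (from a≤[c∸b]/2) djs)
  (λ [c∸b]/2<a w ord → [ id , (λ a*2≤c∸b → contradiction (to a*2≤c∸b) (<⇒≱ [c∸b]/2<a)) ]′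
                          (consecutiveBasis⊎a*2≤c∸b w ord))
  where
  open Shifted n a b c 1≤a a<b b<c c≤n
  open Equivalence (m*n≤o⇔m≤o/n a 2 (c ∸ b))
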